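{- Let $\mathbb{F}$ be a field of characteristic $p$, let $\bar x=(x_1,\dots,x_n)$, and let $d=d_kp^k+\dots+d_1p+d_0$ be the base-$p$ expansion of a positive integer $d$ ($0\le d_i\le p-1$). Then $$\big|\{e_d(\bar x):\bar x\in\{0,1\}^n\}\big|\le\prod_{i\in\{0,\dots,k\},\ d_i\ne0}(p-d_i)+1.$$ In particular, if $d$ has exactly one non-zero digit $d_i$ in its base-$p$ expansion and $d_i\ge2$, then there exists $\beta\in\mathbb{F}$ such that $e_d(\bar x)-\beta=0$ has no solution $\bar x\in\{0,1\}^n$.
   Context: $e_d(\bar x)$ is the elementary symmetric polynomial of degree $d$ in $\bar x$; the set on the left consists of its values in $\mathbb{F}$. -}

module Defs where

open import Level using (Level; _⊔_) renaming (suc to lsuc)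
open import Algebra.Bundles using (CommutativeRing; Semiring)
open import Data.Nat using (ℕ; zero; suc)
import Data.Nat as ℕ
open import Data.Fin using (Fin) renaming (zero to fz; suc to fs)
open import Data.Vec using (Vec; []; _∷_)
open import Data.Bool using (Bool; true; false)
open import Data.List using (List; length)
open import Data.List.Relation.Unary.Any using (Any)
open import Data.Product using (Σ; ∃) renaming (_×_ to _∧_)
open import Relation.Nullary using (¬_)

record Field (c ℓ : Level) : Set (lsuc (c ⊔ ℓ)) where
  field
    commutativeRing : CommutativeRing c ℓ
  open CommutativeRing commutativeRing public
  field
    1≉0     : ¬ (1# ≈ 0#)
    inverse : ∀ x → ¬ (x ≈ 0#) → ∃ λ y → x * y ≈ 1#

module _ {c ℓ : Level} (F : Field c ℓ) where
  open Field F
  open import Algebra.Definitions.RawSemiring (Semiring.rawSemiring semiring) using (_×_)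

  natF : ℕ → Carrier
  natF n = n × 1#

  HasCharacteristic : ℕ → Set ℓ
  HasCharacteristic p =
    (0 ℕ.< p) ∧ (natF p ≈ 0#) ∧ (∀ m → 0 ℕ.< m → m ℕ.< p → ¬ (natF m ≈ 0#))

  esym : ∀ {n} → ℕ → Vec Carrier n → Carrier
  esym zero    _        = 1#
  esym (suc d) []       = 0#
  esym (suc d) (x ∷ xs) = x * esym d xs + esym (suc d) xs

  bit : Bool → Carrier
  bit true  = 1#
  bit false = 0#

  bits : ∀ {n} → Vec Bool n → Vec Carrier n
  bits []       = []
  bits (b ∷ bs) = bit b ∷ bits bs

  ImageCard≤ : {a : Level} {A : Set a} → (A → Carrier) → ℕ → Set (a ⊔ c ⊔ ℓ)
  ImageCard≤ {A = A} f N =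
    Σ (List Carrier) λ L → (length L ℕ.≤ N) ∧ (∀ x → Any (λ y → f x ≈ y) L)

digitValue : ℕ → ∀ {m} → (Fin m → ℕ) → ℕ
digitValue p {zero}  dg = 0
digitValue p {suc m} dg = dg fz ℕ.+ p ℕ.* digitValue p (λ i → dg (fs i))

nzDigitProd : ℕ → ∀ {m} → (Fin m → ℕ) → ℕ
nzDigitProd p {zero}  dg = 1
nzDigitProd p {suc m} dg = factor (dg fz) ℕ.* nzDigitProd p (λ i → dg (fs i))
  where
  factor : ℕ → ℕ
  factor zero    = 1
  factor (suc r) = p ℕ.∸ suc r

-- On a 0/1-vector with w ones, e_d is the binomial coefficient (w C d) read in 𝔽. By Lucas' theorem
-- this is the product over base-p digits of (wᵢ C dᵢ) in 𝔽; a factor with dᵢ = 0 is 1, any other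
-- factor is 0 or one of the p - dᵢ numbers (a C dᵢ) with dᵢ ≤ a < p. So e_d takes at most
-- ∏ (p - dᵢ) values besides 0. If dᵢ ≥ 2 is the only nonzero digit, that is at most p - dᵢ + 1 < p
-- values, while 0, 1, …, p - 1 are p distinct elements of 𝔽, so one of them is never attained.
-- Lucas' theorem itself follows from Pascal's rule by induction on w, using that (p C k) = 0 in 𝔽
-- for 0 < k < p because k (p C k) = p ((p - 1) C (k - 1)) and k is invertible in 𝔽.
module Submission where

open import Defs
open import Level using (Level)
open import Data.Bool using (Bool; true; false)
open import Data.Empty using (⊥-elim)
open import Data.Fin using (Fin; toℕ) renaming (zero to fz; suc to fs)
open import Data.Fin.Properties using (pigeonhole; ¬∀⟶∃¬; toℕ<n; toℕ-injective; <⇒≢; suc-injective)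
open import Data.List using (List; []; _∷_; length; map; lookup; applyUpTo; cartesianProductWith)
open import Data.List.Properties using (length-map; length-++; length-applyUpTo)
open import Data.List.Membership.Propositional using (_∈_; _∉_)
open import Data.List.Membership.Propositional.Properties using (∈-applyUpTo⁺)
open import Data.List.Relation.Unary.Any as Any using (Any; here; there)
open import Data.List.Relation.Unary.Any.Properties using (map⁺; cartesianProductWith⁺; lookup-index)
open import Data.Nat as ℕ using (ℕ; zero; suc; _<_; _≤_; _∸_; s≤s; z<s)
open import Data.Nat.Combinatorics using (_C_; nCk+nC[k+1]≡[n+1]C[k+1]; k>n⇒nCk≡0; nCn≡1; nC1≡n)
open import Data.Nat.DivMod using (_%_; _/_; m≡m%n+[m/n]*n; m%n<n)
import Data.Nat.Properties as ℕₚ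
open import Data.List.Membership.DecPropositional ℕ._≟_ using (_∈?_)
open import Data.Product using (Σ; ∃; _×_; _,_; proj₁; proj₂)
open import Data.Vec using (Vec; []; _∷_; countᵇ)
open import Data.Vec.Functional using (head; tail)
open import Function using (id; _∘_)
open import Relation.Binary.Definitions using (tri<; tri≈; tri>)
open import Relation.Binary.PropositionalEquality
  using (_≡_; _≢_; refl; sym; trans; cong; cong₂; subst; module ≡-Reasoning)
open import Relation.Nullary using (¬_; yes; no)

[k+1]*[n+1]C[k+1]≡[n+1]*nCk : ∀ n k → suc k ℕ.* (suc n C suc k) ≡ suc n ℕ.* (n C k)
[k+1]*[n+1]C[k+1]≡[n+1]*nCk zero    zero    = refl
[k+1]*[n+1]C[k+1]≡[n+1]*nCk zero    (suc k) = ℕₚ.*-zeroʳ (suc (suc k))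
[k+1]*[n+1]C[k+1]≡[n+1]*nCk (suc n) zero    =
  trans (ℕₚ.*-identityˡ _) (trans (nC1≡n (suc (suc n))) (sym (ℕₚ.*-identityʳ _)))
[k+1]*[n+1]C[k+1]≡[n+1]*nCk (suc n) (suc k) = begin
  suc (suc k) ℕ.* (suc (suc n) C suc (suc k))
    ≡⟨ cong (suc (suc k) ℕ.*_) (nCk+nC[k+1]≡[n+1]C[k+1] (suc n) (suc k)) ⟨
  suc (suc k) ℕ.* (X ℕ.+ Y)
    ≡⟨ ℕₚ.*-distribˡ-+ (suc (suc k)) X Y ⟩
  (X ℕ.+ suc k ℕ.* X) ℕ.+ suc (suc k) ℕ.* Y
    ≡⟨ ℕₚ.+-assoc X _ _ ⟩
  X ℕ.+ (suc k ℕ.* X ℕ.+ suc (suc k) ℕ.* Y)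
    ≡⟨ cong₂ (λ u v → X ℕ.+ (u ℕ.+ v)) ([k+1]*[n+1]C[k+1]≡[n+1]*nCk n k)
                                        ([k+1]*[n+1]C[k+1]≡[n+1]*nCk n (suc k)) ⟩
  X ℕ.+ (suc n ℕ.* (n C k) ℕ.+ suc n ℕ.* (n C suc k))
    ≡⟨ cong (X ℕ.+_) (ℕₚ.*-distribˡ-+ (suc n) (n C k) (n C suc k)) ⟨
  X ℕ.+ suc n ℕ.* (n C k ℕ.+ n C suc k)
    ≡⟨ cong (λ u → X ℕ.+ suc n ℕ.* u) (nCk+nC[k+1]≡[n+1]C[k+1] n k) ⟩
  X ℕ.+ suc n ℕ.* X ∎
  where
  open ≡-Reasoning
  X = suc n C suc k
  Y = suc n C suc (suc k)

length-cartesianProductWith : ∀ {a b c} {A : Set a} {B : Set b} {D : Set c} (f : A → B → D) xs ys →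
  length (cartesianProductWith f xs ys) ≡ length xs ℕ.* length ys
length-cartesianProductWith f []       ys = refl
length-cartesianProductWith f (x ∷ xs) ys = trans (length-++ (map (f x) ys))
  (cong₂ ℕ._+_ (length-map (f x) ys) (length-cartesianProductWith f xs ys))

length<⇒∃∉ : ∀ n (xs : List ℕ) → length xs < n → ∃ λ j → j < n × j ∉ xs
length<⇒∃∉ n xs len<n with ¬∀⟶∃¬ n (λ i → toℕ i ∈ xs) (λ i → toℕ i ∈? xs) ¬all∈
  where
  ¬all∈ : ¬ (∀ i → toℕ i ∈ xs)
  ¬all∈ all∈ with pigeonhole len<n (Any.index ∘ all∈)
  ... | i , j , i<j , same = <⇒≢ i<j (toℕ-injective (begin
    toℕ i                          ≡⟨ lookup-index (all∈ i) ⟩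
    lookup xs (Any.index (all∈ i)) ≡⟨ cong (lookup xs) same ⟩
    lookup xs (Any.index (all∈ j)) ≡⟨ lookup-index (all∈ j) ⟨
    toℕ j                          ∎))
    where open ≡-Reasoning
... | i , i∉ = toℕ i , toℕ<n i , i∉

nzDigitProd-zeros : ∀ p {m} (dg : Fin m → ℕ) → (∀ j → dg j ≡ 0) → nzDigitProd p dg ≡ 1
nzDigitProd-zeros p {zero}  _  _     = refl
nzDigitProd-zeros p {suc m} dg zeros rewrite zeros fz =
  trans (ℕₚ.+-identityʳ _) (nzDigitProd-zeros p (tail dg) (zeros ∘ fs))

nzDigitProd-single : ∀ p {m} (dg : Fin m → ℕ) i → 0 < dg i → (∀ j → j ≢ i → dg j ≡ 0) →
  nzDigitProd p dg ≡ p ∸ dg i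
nzDigitProd-single p dg fz 0<dg₀ others with dg fz
... | suc r = trans (cong ((p ∸ suc r) ℕ.*_) (nzDigitProd-zeros p (tail dg) λ j → others (fs j) λ ()))
                    (ℕₚ.*-identityʳ _)
nzDigitProd-single p dg (fs i) 0<dgᵢ others rewrite others fz (λ ()) =
  trans (ℕₚ.+-identityʳ _)
        (nzDigitProd-single p (tail dg) i 0<dgᵢ λ j j≢i → others (fs j) (j≢i ∘ suc-injective))

module _ {c ℓ} (F : Field c ℓ) where
  open Field F renaming (refl to ≈-refl; sym to ≈-sym; trans to ≈-trans) hiding (zero)
  open import Algebra.Properties.Semiring.Mult semiring using (×-homo-+; ×1-homo-*; ×-homo-1)
  open import Algebra.Properties.Group +-group using (identityʳ-unique; x∙y⁻¹≈ε⇒x≈y)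
  open import Relation.Binary.Reasoning.Setoid setoid

  private
    ι : ℕ → Carrier
    ι = natF F

  ι1≈1 : ι 1 ≈ 1#
  ι1≈1 = ×-homo-1 1#

  ι-+ : ∀ m n → ι (m ℕ.+ n) ≈ ι m + ι n
  ι-+ = ×-homo-+ 1#

  ι-* : ∀ m n → ι (m ℕ.* n) ≈ ι m * ι n
  ι-* = ×1-homo-*

  ι-pascal : ∀ n k → ι (suc n C suc k) ≈ ι (n C k) + ι (n C suc k)
  ι-pascal n k = begin
    ι (suc n C suc k)         ≡⟨ cong ι (nCk+nC[k+1]≡[n+1]C[k+1] n k) ⟨
    ι (n C k ℕ.+ n C suc k)   ≈⟨ ι-+ (n C k) (n C suc k) ⟩
    ι (n C k) + ι (n C suc k) ∎

  x≉0⇒x*y≈0⇒y≈0 : ∀ {x y} → x ≉ 0# → x * y ≈ 0# → y ≈ 0#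
  x≉0⇒x*y≈0⇒y≈0 {x} {y} x≉0 xy≈0 with inverse x x≉0
  ... | x⁻¹ , xx⁻¹≈1 = begin
    y              ≈⟨ *-identityˡ y ⟨
    1# * y         ≈⟨ *-congʳ xx⁻¹≈1 ⟨
    (x * x⁻¹) * y  ≈⟨ *-congʳ (*-comm x x⁻¹) ⟩
    (x⁻¹ * x) * y  ≈⟨ *-assoc x⁻¹ x y ⟩
    x⁻¹ * (x * y)  ≈⟨ *-congˡ xy≈0 ⟩
    x⁻¹ * 0#       ≈⟨ zeroʳ x⁻¹ ⟩
    0#             ∎

  esym-bits≈binomial : ∀ {n} d (x : Vec Bool n) → esym F d (bits F x) ≈ ι (countᵇ id x C d)
  esym-bits≈binomial zero    x           = ≈-sym ι1≈1
  esym-bits≈binomial (suc d) []          = ≈-refl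
  esym-bits≈binomial (suc d) (true ∷ x)  = begin
    1# * esym F d (bits F x) + esym F (suc d) (bits F x)
      ≈⟨ +-cong (≈-trans (*-identityˡ _) (esym-bits≈binomial d x)) (esym-bits≈binomial (suc d) x) ⟩
    ι (countᵇ id x C d) + ι (countᵇ id x C suc d)
      ≈⟨ ι-pascal (countᵇ id x) d ⟨
    ι (suc (countᵇ id x) C suc d) ∎
  esym-bits≈binomial (suc d) (false ∷ x) =
    ≈-trans (+-congʳ (zeroˡ _)) (≈-trans (+-identityˡ _) (esym-bits≈binomial (suc d) x))

  module _ (p-1 : ℕ) (char : HasCharacteristic F (suc p-1)) where
    private
      p : ℕ
      p = suc p-1

      ι[p]≈0 : ι p ≈ 0#
      ι[p]≈0 = proj₁ (proj₂ char)

      ι≉0 : ∀ m → 0 < m → m < p → ι m ≉ 0#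
      ι≉0 = proj₂ (proj₂ char)

    ι[m*p]≈0 : ∀ m → ι (m ℕ.* p) ≈ 0#
    ι[m*p]≈0 m = ≈-trans (ι-* m p) (≈-trans (*-congˡ ι[p]≈0) (zeroʳ (ι m)))

    ι[pCk]≈0 : ∀ {k} → 0 < k → k < p → ι (p C k) ≈ 0#
    ι[pCk]≈0 {suc j} _ k<p = x≉0⇒x*y≈0⇒y≈0 (ι≉0 (suc j) z<s k<p) (begin
      ι (suc j) * ι (p C suc j)    ≈⟨ ι-* (suc j) (p C suc j) ⟨
      ι (suc j ℕ.* (p C suc j))    ≡⟨ cong ι ([k+1]*[n+1]C[k+1]≡[n+1]*nCk p-1 j) ⟩
      ι (p ℕ.* (p-1 C j))          ≡⟨ cong ι (ℕₚ.*-comm p (p-1 C j)) ⟩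
      ι ((p-1 C j) ℕ.* p)          ≈⟨ ι[m*p]≈0 (p-1 C j) ⟩
      0#                           ∎)

    ι[n]≈ι[n%p] : ∀ n → ι n ≈ ι (n % p)
    ι[n]≈ι[n%p] n = begin
      ι n                          ≡⟨ cong ι (m≡m%n+[m/n]*n n p) ⟩
      ι (n % p ℕ.+ n / p ℕ.* p)    ≈⟨ ι-+ (n % p) (n / p ℕ.* p) ⟩
      ι (n % p) + ι (n / p ℕ.* p)  ≈⟨ +-congˡ (ι[m*p]≈0 (n / p)) ⟩
      ι (n % p) + 0#               ≈⟨ +-identityʳ (ι (n % p)) ⟩
      ι (n % p)                    ∎

    ι[a]≉ι[b] : ∀ {a b} → a < b → b < p → ι a ≉ ι b
    ι[a]≉ι[b] {a} {b} a<b b<p ιa≈ιb =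
      ι≉0 (b ∸ a) (ℕₚ.m<n⇒0<n∸m a<b) (ℕₚ.≤-<-trans (ℕₚ.m∸n≤m b a) b<p)
        (identityʳ-unique (ι a) (ι (b ∸ a)) (begin
          ι a + ι (b ∸ a)   ≈⟨ ι-+ a (b ∸ a) ⟨
          ι (a ℕ.+ (b ∸ a)) ≡⟨ cong ι (ℕₚ.m+[n∸m]≡n (ℕₚ.<⇒≤ a<b)) ⟩
          ι b               ≈⟨ ιa≈ιb ⟨
          ι a               ∎))

    ι-injective : ∀ {a b} → a < p → b < p → ι a ≈ ι b → a ≡ b
    ι-injective {a} {b} a<p b<p ιa≈ιb with ℕₚ.<-cmp a b
    ... | tri< a<b _ _ = ⊥-elim (ι[a]≉ι[b] a<b b<p ιa≈ιb)
    ... | tri≈ _ a≡b _ = a≡b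
    ... | tri> _ _ b<a = ⊥-elim (ι[a]≉ι[b] b<a a<p (≈-sym ιa≈ιb))

    -- High digits are written b * p, not p * b, so that suc b * p reduces to suc (p-1 + b * p):
    -- the predecessor of the number with digits (0, suc b) has digits (p-1, b) definitionally.
    Lucas : ℕ → ℕ → Set ℓ
    Lucas a b = ∀ e f → e < p → ι ((a ℕ.+ b ℕ.* p) C (e ℕ.+ f ℕ.* p)) ≈ ι (a C e) * ι (b C f)

    ι1≈ι1*ι1 : ι 1 ≈ ι 1 * ι 1
    ι1≈ι1*ι1 = ≈-sym (≈-trans (*-congʳ ι1≈1) (*-identityˡ (ι 1)))

    lucas-0-0 : Lucas 0 0
    lucas-0-0 zero    zero    _ = ι1≈ι1*ι1
    lucas-0-0 zero    (suc f) _ = ≈-sym (zeroʳ (ι 1))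
    lucas-0-0 (suc e) f       _ = ≈-sym (zeroˡ (ι (0 C f)))

    lucas-pascal : ∀ {a b} → Lucas a b → ∀ e f → suc e < p →
      ι (suc (a ℕ.+ b ℕ.* p) C suc (e ℕ.+ f ℕ.* p)) ≈ ι (suc a C suc e) * ι (b C f)
    lucas-pascal {a} {b} IH e f e+1<p = begin
      ι (suc n C suc k)                    ≈⟨ ι-pascal n k ⟩
      ι (n C k) + ι (n C suc k)            ≈⟨ +-cong (IH e f (ℕₚ.<⇒≤ e+1<p)) (IH (suc e) f e+1<p) ⟩
      ι (a C e) * Y + ι (a C suc e) * Y    ≈⟨ distribʳ Y (ι (a C e)) (ι (a C suc e)) ⟨
      (ι (a C e) + ι (a C suc e)) * Y      ≈⟨ *-congʳ (ι-pascal a e) ⟨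
      ι (suc a C suc e) * Y                ∎
      where
      n = a ℕ.+ b ℕ.* p
      k = e ℕ.+ f ℕ.* p
      Y = ι (b C f)

    lucas-suc-digit : ∀ {a b} → suc a < p → Lucas a b → Lucas (suc a) b
    lucas-suc-digit _ _ zero zero _ = ι1≈ι1*ι1
    lucas-suc-digit _ IH (suc e) f e+1<p = lucas-pascal IH e f e+1<p
    lucas-suc-digit {a} {b} (s≤s a<p-1) IH zero (suc f) _ = begin
      ι (suc n C suc (p-1 ℕ.+ f ℕ.* p))
        ≈⟨ ι-pascal n (p-1 ℕ.+ f ℕ.* p) ⟩
      ι (n C (p-1 ℕ.+ f ℕ.* p)) + ι (n C (suc f ℕ.* p))
        ≈⟨ +-cong (IH p-1 f ℕₚ.≤-refl) (IH 0 (suc f) z<s) ⟩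
      ι (a C p-1) * ι (b C f) + ι 1 * Y
        ≡⟨ cong (λ m → ι m * ι (b C f) + ι 1 * Y) (k>n⇒nCk≡0 a<p-1) ⟩
      0# * ι (b C f) + ι 1 * Y
        ≈⟨ +-congʳ (zeroˡ (ι (b C f))) ⟩
      0# + ι 1 * Y
        ≈⟨ +-identityˡ (ι 1 * Y) ⟩
      ι 1 * Y ∎
      where
      n = a ℕ.+ b ℕ.* p
      Y = ι (b C suc f)

    lucas-carry : ∀ {b} → Lucas p-1 b → Lucas 0 (suc b)
    lucas-carry _ zero zero _ = ι1≈ι1*ι1
    lucas-carry {b} IH (suc e) f e+1<p = begin
      ι (suc n C suc (e ℕ.+ f ℕ.* p))   ≈⟨ lucas-pascal IH e f e+1<p ⟩
      ι (p C suc e) * ι (b C f)         ≈⟨ *-congʳ (ι[pCk]≈0 z<s e+1<p) ⟩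
      0# * ι (b C f)                    ≈⟨ zeroˡ (ι (b C f)) ⟩
      0#                                ≈⟨ zeroˡ (ι (suc b C f)) ⟨
      0# * ι (suc b C f)                ∎
      where
      n = p-1 ℕ.+ b ℕ.* p
    lucas-carry {b} IH zero (suc f) _ = begin
      ι (suc n C suc (p-1 ℕ.+ f ℕ.* p))
        ≈⟨ ι-pascal n (p-1 ℕ.+ f ℕ.* p) ⟩
      ι (n C (p-1 ℕ.+ f ℕ.* p)) + ι (n C (suc f ℕ.* p))
        ≈⟨ +-cong (IH p-1 f ℕₚ.≤-refl) (IH 0 (suc f) z<s) ⟩
      ι (p-1 C p-1) * ι (b C f) + ι 1 * ι (b C suc f)
        ≡⟨ cong (λ m → ι m * ι (b C f) + ι 1 * ι (b C suc f)) (nCn≡1 p-1) ⟩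
      ι 1 * ι (b C f) + ι 1 * ι (b C suc f)
        ≈⟨ distribˡ (ι 1) (ι (b C f)) (ι (b C suc f)) ⟨
      ι 1 * (ι (b C f) + ι (b C suc f))
        ≈⟨ *-congˡ (ι-pascal b f) ⟨
      ι 1 * ι (suc b C suc f) ∎
      where
      n = p-1 ℕ.+ b ℕ.* p

    lucas : ∀ a b → a < p → Lucas a b
    lucas zero    zero    _     = lucas-0-0
    lucas (suc a) b       a+1<p = lucas-suc-digit a+1<p (lucas a b (ℕₚ.<⇒≤ a+1<p))
    lucas zero    (suc b) _     = lucas-carry (lucas p-1 b ℕₚ.≤-refl)

    lucas-divMod : ∀ w e f → e < p → ι (w C (e ℕ.+ p ℕ.* f)) ≈ ι (w % p C e) * ι (w / p C f)
    lucas-divMod w e f e<p = ≈-trans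
      (reflexive (cong₂ (λ n k → ι (n C k)) (m≡m%n+[m/n]*n w p) (cong (e ℕ.+_) (ℕₚ.*-comm p f))))
      (lucas (w % p) (w / p) (m%n<n w p) e f e<p)

    digitBinomials : ℕ → List ℕ
    digitBinomials zero    = 1 ∷ []
    digitBinomials (suc r) = applyUpTo (λ j → (suc r ℕ.+ j) C suc r) (p ∸ suc r)

    digitBinomial∈ : ∀ {a} r → a < p → a C r ∈ 0 ∷ digitBinomials r
    digitBinomial∈ zero _ = there (here refl)
    digitBinomial∈ {a} (suc r) a<p with a ℕ.<? suc r
    ... | yes a<r+1 = here (k>n⇒nCk≡0 a<r+1)
    ... | no  a≮r+1 = there (subst (λ m → m C suc r ∈ digitBinomials (suc r)) (ℕₚ.m+[n∸m]≡n r+1≤a)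
                               (∈-applyUpTo⁺ _ (ℕₚ.∸-monoˡ-< a<p r+1≤a)))
      where
      r+1≤a = ℕₚ.≮⇒≥ a≮r+1

    digitProducts : ∀ {m} → (Fin m → ℕ) → List ℕ
    digitProducts {zero}  dg = 1 ∷ []
    digitProducts {suc m} dg =
      cartesianProductWith ℕ._*_ (digitBinomials (head dg)) (digitProducts (tail dg))

    length-digitProducts : ∀ {m} (dg : Fin m → ℕ) → length (digitProducts dg) ≡ nzDigitProd p dg
    length-digitProducts {zero}  dg = refl
    length-digitProducts {suc m} dg
      rewrite length-cartesianProductWith ℕ._*_ (digitBinomials (head dg)) (digitProducts (tail dg))
            | length-digitProducts (tail dg)
      with head dg
    ... | zero  = refl
    ... | suc r = cong (ℕ._* nzDigitProd p (tail dg)) (length-applyUpTo _ (p ∸ suc r))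

    _∈ι_ : Carrier → List ℕ → Set ℓ
    x ∈ι us = Any (λ u → x ≈ ι u) us

    ∈ι-* : ∀ {x y z S R} → z ≈ x * y → x ∈ι (0 ∷ S) → y ∈ι (0 ∷ R) →
           z ∈ι (0 ∷ cartesianProductWith ℕ._*_ S R)
    ∈ι-* z≈xy (here x≈0) _ = here (≈-trans z≈xy (≈-trans (*-congʳ x≈0) (zeroˡ _)))
    ∈ι-* z≈xy (there _) (here y≈0) = here (≈-trans z≈xy (≈-trans (*-congˡ y≈0) (zeroʳ _)))
    ∈ι-* {x} {y} {z} z≈xy (there x∈S) (there y∈R) =
      there (cartesianProductWith⁺ ℕ._*_ (λ {u} {v} → product u v) x∈S y∈R)
      where
      product : ∀ u v → x ≈ ι u → y ≈ ι v → z ≈ ι (u ℕ.* v)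
      product u v x≈ιu y≈ιv = ≈-trans z≈xy (≈-trans (*-cong x≈ιu y≈ιv) (≈-sym (ι-* u v)))

    -- The entry 0 covers every w with some base-p digit below the corresponding digit of d.
    binomial∈ι : ∀ {m} (dg : Fin m → ℕ) → (∀ i → dg i < p) → ∀ w →
                 ι (w C digitValue p dg) ∈ι (0 ∷ digitProducts dg)
    binomial∈ι {zero}  _  _    _ = there (here ≈-refl)
    binomial∈ι {suc m} dg dg<p w = ∈ι-* (lucas-divMod w (head dg) (digitValue p (tail dg)) (dg<p fz))
      (Any.map (λ eq → reflexive (cong ι eq)) (digitBinomial∈ (head dg) (m%n<n w p)))
      (binomial∈ι (tail dg) (dg<p ∘ fs) (w / p))

    esym-bits∈ι : ∀ {n m} (dg : Fin m → ℕ) → (∀ i → dg i < p) → (x : Vec Bool n) →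
                  esym F (digitValue p dg) (bits F x) ∈ι (0 ∷ digitProducts dg)
    esym-bits∈ι dg dg<p x =
      Any.map (≈-trans (esym-bits≈binomial (digitValue p dg) x)) (binomial∈ι dg dg<p (countᵇ id x))

    ∃ι∉ι : ∀ us → length us < p → ∃ λ j → ¬ (ι j ∈ι us)
    ∃ι∉ι us len<p with length<⇒∃∉ p (map (_% p) us) (subst (_< p) (sym (length-map (_% p) us)) len<p)
    ... | j , j<p , j∉ = j , λ ιj∈ι → j∉ (map⁺ (Any.map (λ {u} → j≡u%p u) ιj∈ι))
      where
      j≡u%p : ∀ u → ι j ≈ ι u → j ≡ u % p
      j≡u%p u ιj≈ιu = ι-injective j<p (m%n<n u p) (≈-trans ιj≈ιu (ι[n]≈ι[n%p] u))

    esym-imageCard≤ : ∀ n {m} (dg : Fin m → ℕ) → (∀ i → dg i < p) →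
      ImageCard≤ F (λ (x : Vec Bool n) → esym F (digitValue p dg) (bits F x)) (nzDigitProd p dg ℕ.+ 1)
    esym-imageCard≤ n dg dg<p =
      map ι (0 ∷ digitProducts dg) , length≤ , λ x → map⁺ (esym-bits∈ι dg dg<p x)
      where
      length≤ : length (map ι (0 ∷ digitProducts dg)) ≤ nzDigitProd p dg ℕ.+ 1
      length≤ = ℕₚ.≤-reflexive (trans (length-map ι (0 ∷ digitProducts dg))
        (trans (cong suc (length-digitProducts dg)) (ℕₚ.+-comm 1 (nzDigitProd p dg))))

    esym-misses-value : ∀ n {m} (dg : Fin m → ℕ) → (∀ i → dg i < p) →
      (Σ (Fin m) λ i → (2 ≤ dg i) × (∀ j → j ≢ i → dg j ≡ 0)) →
      Σ Carrier λ β → ∀ (x : Vec Bool n) → ¬ (esym F (digitValue p dg) (bits F x) - β ≈ 0#)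
    esym-misses-value n dg dg<p (i , 2≤dgᵢ , others) with ∃ι∉ι (0 ∷ digitProducts dg) short
      where
      short : suc (length (digitProducts dg)) < p
      short = subst (λ l → suc l < p)
        (sym (trans (length-digitProducts dg) (nzDigitProd-single p dg i (ℕₚ.<-trans z<s 2≤dgᵢ) others)))
        (s≤s (ℕₚ.∸-monoʳ-< 2≤dgᵢ (ℕₚ.<⇒≤ (dg<p i))))
    ... | j , ιj∉ι = ι j , λ x e-ιj≈0 →
      ιj∉ι (Any.map (≈-trans (≈-sym (x∙y⁻¹≈ε⇒x≈y _ _ e-ιj≈0))) (esym-bits∈ι dg dg<p x))

open import Data.Nat using (_+_)

lemma4p3 : ∀ {c ℓ : Level} (F : Field c ℓ) (p : ℕ) → HasCharacteristic F p →
    (n d k : ℕ) (dg : Fin (suc k) → ℕ) → (∀ i → dg i < p) →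
    d ≡ digitValue p dg → 0 < d →
    ImageCard≤ F (λ (x : Vec Bool n) → esym F d (bits F x)) (nzDigitProd p dg + 1)
    × ((Σ (Fin (suc k)) λ i → (2 ≤ dg i) × (∀ j → j ≢ i → dg j ≡ 0)) →
       Σ (Field.Carrier F) λ β → ∀ (x : Vec Bool n) →
         ¬ (Field._≈_ F (Field._-_ F (esym F d (bits F x)) β) (Field.0# F)))
lemma4p3 F zero      (() , _)
lemma4p3 F (suc p-1) char n _ k dg dg<p refl _ =
  esym-imageCard≤ F p-1 char n dg dg<p , esym-misses-value F p-1 char n dg dg<p
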